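{- Let $\gamma$ be an infinite limit ordinal and let $u=(\alpha,\beta)$ and $v=(0,\xi)$ be distinct vertices of $\mathcal G_\gamma$ with $0\leq\alpha<\beta<\xi$. If $\alpha=0$ then $u\leq_1 v$, and if $0<\alpha$ then $u\leq_\alpha v$. In particular, $\eta(u,v)\leq\alpha+1$.
   Context: $\mathcal G_\gamma$ is the graph with vertex set $\gamma\times\gamma$ in which two distinct vertices $(\alpha_0,\beta_0),(\alpha_1,\beta_1)$ are adjacent iff $\alpha_0=\alpha_1=0$, or $\beta_0=\beta_1=0$, or ($\alpha_0=\beta_0$ and $\alpha_1=\beta_1$), or ($\alpha_0<\alpha_1$ and $\beta_0>\beta_1$), or ($\alpha_0>\alpha_1$ and $\beta_0<\beta_1$). $N[v]$ is the closed neighbourhood of $v$. Relations $\leq_\alpha$ on the vertex set for ordinals $\alpha$: $u\leq_0 v$ iff $u=v$; $u\leq_\alpha v$ if for every $x\in N[u]$ there is $y\in N[v]$ with $x\leq_\delta y$ for some $\delta<\alpha$. $\eta(u,v)$ is the minimum ordinal $\alpha$ with $u\leq_\alpha v$. -}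

module Defs where

open import Data.Product using (Σ; _×_; _,_)
open import Data.Sum using (_⊎_)
open import Relation.Nullary using (¬_)
open import Relation.Binary.PropositionalEquality using (_≡_; _≢_)
open import Relation.Binary.Structures using (IsStrictTotalOrder)
open import Induction.WellFounded using (WellFounded)

-- An infinite limit ordinal γ, presented as its set of elements {δ : δ < γ}
-- with the ordinal order: a well-founded strict total order (i.e. a
-- well-order, hence isomorphic to a unique ordinal), which is nonempty
-- (has least element 0) and has no largest element (every element has an
-- immediate successor inside γ).  Nonempty + no maximum = infinite limit.
record InfLimitOrdinal : Set₁ where
  field
    Ord   : Set
    _<_   : Ord → Ord → Set
    isSTO : IsStrictTotalOrder _≡_ _<_
    wf    : WellFounded _<_
    zero       : Ord
    zero-least : ∀ x → ¬ (x < zero)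
    suc        : Ord → Ord            -- successor δ+1 (exists since γ is limit)
    suc-above  : ∀ x → x < suc x
    suc-least  : ∀ x y → x < y → y ≡ suc x ⊎ suc x < y

  _≤_ : Ord → Ord → Set
  x ≤ y = x ≡ y ⊎ x < y

module Graph (O : InfLimitOrdinal) where
  open InfLimitOrdinal O

  V : Set
  V = Ord × Ord

  AdjCond : V → V → Set
  AdjCond (a₀ , b₀) (a₁ , b₁) =
      (a₀ ≡ zero × a₁ ≡ zero)
    ⊎ (b₀ ≡ zero × b₁ ≡ zero)
    ⊎ (a₀ ≡ b₀ × a₁ ≡ b₁)
    ⊎ (a₀ < a₁ × b₁ < b₀)
    ⊎ (a₁ < a₀ × b₀ < b₁)

  Adj : V → V → Set
  Adj u x = u ≢ x × AdjCond u x

  N : V → V → Set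
  N u x = x ≡ u ⊎ Adj u x

  data _≤[_]_ : V → Ord → V → Set where
    le-zero : ∀ {u} → u ≤[ zero ] u
    le-step : ∀ {u α v} →
      (∀ x → N u x → Σ V λ y → N v y × Σ Ord λ δ → δ < α × x ≤[ δ ] y) →
      u ≤[ α ] v

{-# OPTIONS --safe #-}
-- Every vertex (0 , b) and every (a , b) with 0 < a and b < ξ lies in N[(0 , ξ)].
-- For α = 0 this gives N[u] ⊆ N[v].  For 0 < α, the neighbours of u = (α , β)
-- are (a , b) with either α < a and b < β, which lie in N[v], or a < α < β < b.
-- In the latter case either a = 0, or (a , b) ≤_a (0 , b + 1) by well-founded
-- induction on α, and (0 , b + 1) ∈ N[v].
module Submission where

open import Defs
open import Data.Product using (Σ; _×_; _,_; proj₁; proj₂)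
open import Data.Sum using (_⊎_; inj₁; inj₂)
open import Data.Empty using (⊥-elim)
open import Relation.Nullary using (yes; no)
open import Relation.Binary.PropositionalEquality using (_≡_; _≢_; refl; sym; cong; subst)
open import Relation.Binary.Definitions using (tri<; tri≈; tri>)
open import Relation.Binary.Structures using (IsStrictTotalOrder)
open import Induction.WellFounded using (Acc; acc)

module _ (O : InfLimitOrdinal) where
  open InfLimitOrdinal O
  open Graph O
  open IsStrictTotalOrder isSTO using (compare; trans; irrefl; _≟_)

  zero-or-positive : ∀ x → x ≡ zero ⊎ zero < x
  zero-or-positive x with compare zero x
  ... | tri< 0<x _ _ = inj₂ 0<x
  ... | tri≈ _ 0≡x _ = inj₁ (sym 0≡x)
  ... | tri> _ _ x<0 = ⊥-elim (zero-least x x<0)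

  N-axis : ∀ ξ b → N (zero , ξ) (zero , b)
  N-axis ξ b with b ≟ ξ
  ... | yes refl = inj₁ refl
  ... | no b≢ξ = inj₂ ((λ eq → b≢ξ (sym (cong proj₂ eq))) , inj₁ (refl , refl))

  N-below : ∀ ξ {a b} → zero < a → b < ξ → N (zero , ξ) (a , b)
  N-below ξ 0<a b<ξ =
    inj₂ ((λ eq → irrefl (cong proj₁ eq) 0<a) , inj₂ (inj₂ (inj₂ (inj₁ (0<a , b<ξ)))))

  Dominated : Ord → V → V → Set
  Dominated α v x = Σ V λ y → N v y × Σ Ord λ δ → δ < α × x ≤[ δ ] y

  dominated-by-itself : ∀ {α v x} → zero < α → N v x → Dominated α v x
  dominated-by-itself 0<α x∈Nv = _ , x∈Nv , zero , 0<α , le-zero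

  ⊆⇒≤ : ∀ {α u v} → zero < α → (∀ x → N u x → N v x) → u ≤[ α ] v
  ⊆⇒≤ 0<α Nu⊆Nv = le-step λ x x∈Nu → dominated-by-itself 0<α (Nu⊆Nv x x∈Nu)

  N-axis-mono : ∀ {β ξ} → zero < β → β < ξ → ∀ x → N (zero , β) x → N (zero , ξ) x
  N-axis-mono 0<β β<ξ x (inj₁ refl) = N-axis _ _
  N-axis-mono 0<β β<ξ x (inj₂ (_ , inj₁ (_ , refl))) = N-axis _ _
  N-axis-mono 0<β β<ξ x (inj₂ (_ , inj₂ (inj₁ (β≡0 , _)))) = ⊥-elim (irrefl (sym β≡0) 0<β)
  N-axis-mono 0<β β<ξ x (inj₂ (_ , inj₂ (inj₂ (inj₁ (0≡β , _))))) = ⊥-elim (irrefl 0≡β 0<β)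
  N-axis-mono 0<β β<ξ x (inj₂ (_ , inj₂ (inj₂ (inj₂ (inj₁ (0<a , b<β)))))) =
    N-below _ 0<a (trans b<β β<ξ)
  N-axis-mono 0<β β<ξ x (inj₂ (_ , inj₂ (inj₂ (inj₂ (inj₂ (a<0 , _)))))) =
    ⊥-elim (zero-least _ a<0)

  AdjCond-above-diagonal : ∀ {α β a b} → zero < α → α < β → AdjCond (α , β) (a , b) →
    (α < a × b < β) ⊎ (a < α × β < b)
  AdjCond-above-diagonal 0<α α<β (inj₁ (α≡0 , _)) = ⊥-elim (irrefl (sym α≡0) 0<α)
  AdjCond-above-diagonal 0<α α<β (inj₂ (inj₁ (β≡0 , _))) =
    ⊥-elim (zero-least _ (subst (_ <_) β≡0 α<β))
  AdjCond-above-diagonal 0<α α<β (inj₂ (inj₂ (inj₁ (α≡β , _)))) = ⊥-elim (irrefl α≡β α<β)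
  AdjCond-above-diagonal 0<α α<β (inj₂ (inj₂ (inj₂ crossing))) = crossing

  ≤-axis : ∀ {α} → Acc _<_ α → ∀ {β ξ} → zero < α → α < β → β < ξ →
    (α , β) ≤[ α ] (zero , ξ)
  ≤-axis {α} (acc rec) {β} {ξ} 0<α α<β β<ξ = le-step dominated
    where
    dominated : ∀ x → N (α , β) x → Dominated α (zero , ξ) x
    dominated x (inj₁ refl) = dominated-by-itself 0<α (N-below ξ 0<α β<ξ)
    dominated (a , b) (inj₂ (_ , adj)) with AdjCond-above-diagonal 0<α α<β adj
    ... | inj₁ (α<a , b<β) =
      dominated-by-itself 0<α (N-below ξ (trans 0<α α<a) (trans b<β β<ξ))
    ... | inj₂ (a<α , β<b) with zero-or-positive a
    ...   | inj₁ refl = dominated-by-itself 0<α (N-axis ξ b)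
    ...   | inj₂ 0<a = (zero , suc b) , N-axis ξ (suc b) , a , a<α ,
              ≤-axis (rec a<α) 0<a (trans a<α (trans α<β β<b)) (suc-above b)

lemma3 : (O : InfLimitOrdinal) → let open InfLimitOrdinal O in let open Graph O in
    (α β ξ : Ord) → α < β → β < ξ → (α , β) ≢ (zero , ξ) →
    (α ≡ zero → (α , β) ≤[ suc zero ] (zero , ξ))
    × (zero < α → (α , β) ≤[ α ] (zero , ξ))
    × Σ Ord (λ δ → δ ≤ suc α × (α , β) ≤[ δ ] (zero , ξ))
lemma3 O α β ξ α<β β<ξ _ = on-axis , off-axis , η-bound
  where
  open InfLimitOrdinal O
  open Graph O

  on-axis : α ≡ zero → (α , β) ≤[ suc zero ] (zero , ξ)
  on-axis refl = ⊆⇒≤ O (suc-above zero) (N-axis-mono O α<β β<ξ)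

  off-axis : zero < α → (α , β) ≤[ α ] (zero , ξ)
  off-axis 0<α = ≤-axis O (wf α) 0<α α<β β<ξ

  η-bound : Σ Ord (λ δ → δ ≤ suc α × (α , β) ≤[ δ ] (zero , ξ))
  η-bound with zero-or-positive O α
  ... | inj₁ refl = suc zero , inj₁ refl , on-axis refl
  ... | inj₂ 0<α = α , inj₂ (suc-above α) , off-axis 0<α
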